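{- Let $T$ be a tree with $n\ge 1$ vertices $v_1,\dots,v_n$, and let $\mu=(\mu_1,\dots,\mu_n)$ be a minimally self-reachable configuration on $T$. Then for every $i\in\{1,\dots,n\}$ we have $\mu_i\le \deg(v_i)$.
   Context: A chip configuration on $T$ is a vector $c=(c_1,\dots,c_n)\in\mathbb{Z}_{\ge 0}^n$, where $c_i$ is the number of chips on $v_i$; the number of chips of $c$ on a subtree is the sum of the $c_i$ over its vertices. The Laplacian $\Delta(T)$ is the $n\times n$ matrix with $\Delta_{ii}=\deg(v_i)$, $\Delta_{ij}=-1$ if $v_iv_j$ is an edge, and $0$ otherwise. Firing $v_i$ from $c$ produces $c-\Delta(T)e_i$ ($e_i$ the $i$th standard basis vector); the firing is legal if $c_i\ge\deg(v_i)$. A configuration $c$ is self-reachable on $T$ if there is a nonempty finite sequence of legal firings starting from $c$ that ends at $c$. (It is known that $c$ is self-reachable on $T$ iff for every subtree, i.e. connected subgraph, of $T$ with $m$ vertices, $c$ has at least $m-1$ chips on it.) A configuration is minimally self-reachable on $T$ if it is self-reachable on $T$ and has exactly $n-1$ chips in total. -}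

module Defs where

open import Data.Nat using (ℕ; zero; suc; _≤_; _∸_)
open import Data.Fin using (Fin; _≟_)
open import Data.Bool using (Bool; true; false; if_then_else_)
open import Data.List using (List; []; _∷_; _++_; [_]; length; map; allFin)
open import Data.Nat.ListAction using (sum)
open import Data.List.Relation.Unary.Unique.Propositional using (Unique)
open import Data.Product using (_×_; Σ; ∃; ∃-syntax)
open import Data.Unit using (⊤)
open import Relation.Nullary using (¬_; does)
open import Relation.Binary.PropositionalEquality using (_≡_; _≢_)

Graph : ℕ → Set
Graph n = Fin n → Fin n → Bool

module _ {n : ℕ} (G : Graph n) where

  Adj : Fin n → Fin n → Set
  Adj u v = G u v ≡ true

  IsSimple : Set
  IsSimple = (∀ u v → G u v ≡ G v u) × (∀ u → G u u ≡ false)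

  data Walk : Fin n → Fin n → Set where
    here : ∀ {u} → Walk u u
    step : ∀ {u w v} → Adj u w → Walk w v → Walk u v

  Connected : Set
  Connected = ∀ u v → Walk u v

  Chain : List (Fin n) → Set
  Chain []           = ⊤
  Chain (x ∷ [])     = ⊤
  Chain (x ∷ y ∷ zs) = Adj x y × Chain (y ∷ zs)

  Cycle : Set
  Cycle = Σ (Fin n) λ x → Σ (List (Fin n)) λ ys →
            (2 ≤ length ys) × Unique (x ∷ ys) × Chain (x ∷ ys ++ [ x ])

  IsTree : Set
  IsTree = IsSimple × Connected × ¬ Cycle

  deg : Fin n → ℕ
  deg i = sum (map (λ j → if G i j then 1 else 0) (allFin n))

  Config : Set
  Config = Fin n → ℕ

  totalChips : Config → ℕ
  totalChips c = sum (map c (allFin n))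

  -- firing vertex i from c : c - Δ e_i
  fire : Fin n → Config → Config
  fire i c j = if does (i ≟ j) then c j ∸ deg i
               else (if G i j then suc (c j) else c j)

  fireSeq : List (Fin n) → Config → Config
  fireSeq []       c = c
  fireSeq (i ∷ is) c = fireSeq is (fire i c)

  Legal : List (Fin n) → Config → Set
  Legal []       c = ⊤
  Legal (i ∷ is) c = (deg i ≤ c i) × Legal is (fire i c)

  SelfReachable : Config → Set
  SelfReachable c = ∃[ is ] (is ≢ []) × Legal is c × (∀ j → fireSeq is c j ≡ c j)

  MinimallySelfReachable : Config → Set
  MinimallySelfReachable c = SelfReachable c × totalChips c ≡ n ∸ 1

-- Fix a nonempty firing sequence that returns to μ.  A vertex that never fires
-- only gains chips, one from each firing of a neighbour, so by connectivity
-- every vertex fires.  Every neighbour of v that fires after the last firing of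
-- v hands v a chip that v keeps; hence the number a(v) of such neighbours
-- satisfies a(v) ≤ μ(v), and clearly a(v) ≤ deg(v).  Of the two endpoints of an
-- edge, one fires after the last firing of the other, so ∑ a(v) is at least the
-- number of edges of a spanning tree, n − 1 = ∑ μ(v).  As a ≤ μ pointwise,
-- μ = a ≤ deg.
module Submission where

open import Defs
open import Data.Nat using (ℕ; _≤_)
open import Data.Fin using (Fin)

open import Data.Bool using (Bool; true; false; _∧_; _∨_; not; if_then_else_)
import Data.Bool.Properties as Bool
open import Data.Fin using (zero; suc; _≟_)
open import Data.Fin.Properties using (any?)
open import Data.List using (List; []; _∷_; map; allFin; tabulate)
open import Data.List.Properties using (map-tabulate)
open import Data.List.Relation.Unary.Any using (here; there)
import Data.Nat.ListAction as List
open import Data.Nat using (zero; suc; _+_; _∸_; _<_; z≤n; s≤s)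
open import Data.Nat.Induction using (<-wellFounded)
open import Data.Nat.Properties hiding (_≟_)
open import Data.Product using (∃-syntax; _×_; _,_; proj₁; proj₂)
open import Data.Sum using (_⊎_; inj₁; inj₂)
open import Function using (id; _∘_)
open import Induction.WellFounded using (Acc; acc)
open import Relation.Binary.PropositionalEquality
  using (_≡_; _≢_; refl; sym; trans; cong; cong₂; subst)
open import Relation.Nullary using (yes; no; does; contradiction)
open import Relation.Nullary.Decidable using (dec-true; _⊎-dec_; _×-dec_)
open import Relation.Unary using (Decidable)

open import Algebra.Properties.CommutativeMonoid.Sum +-0-commutativeMonoid
  using (sum-syntax; ∑-distrib-+; ∑-comm; sum-cong-≗; sum-replicate-zero)

⟦_⟧ : Bool → ℕ
⟦ b ⟧ = if b then 1 else 0

⟦∧⟧-monoˡ : ∀ {a b} c → (a ≡ true → b ≡ true) → ⟦ a ∧ c ⟧ ≤ ⟦ b ∧ c ⟧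
⟦∧⟧-monoˡ {false}         c a⇒b = z≤n
⟦∧⟧-monoˡ {true}  {true}  c a⇒b = ≤-refl
⟦∧⟧-monoˡ {true}  {false} c a⇒b with () ← a⇒b refl

⟦∧⟧≤⟦⟧ : ∀ a b → ⟦ a ∧ b ⟧ ≤ ⟦ a ⟧
⟦∧⟧≤⟦⟧ false b     = z≤n
⟦∧⟧≤⟦⟧ true  false = z≤n
⟦∧⟧≤⟦⟧ true  true  = ≤-refl

⟦∧∨⟧≤ : ∀ a b c → ⟦ a ∧ (b ∨ c) ⟧ ≤ (if b then ⟦ a ⟧ else 0) + ⟦ a ∧ c ⟧
⟦∧∨⟧≤ false b     c = z≤n
⟦∧∨⟧≤ true  true  c = s≤s z≤n
⟦∧∨⟧≤ true  false c = ≤-refl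

∑-mono-≤ : ∀ {n} {f g : Fin n → ℕ} → (∀ i → f i ≤ g i) → ∑[ i < n ] f i ≤ ∑[ i < n ] g i
∑-mono-≤ {zero}  f≤g = z≤n
∑-mono-≤ {suc n} f≤g = +-mono-≤ (f≤g zero) (∑-mono-≤ (f≤g ∘ suc))

∑-mono-≤-tight : ∀ {n} {f g : Fin n → ℕ} → (∀ i → f i ≤ g i) →
                 ∑[ i < n ] g i ≤ ∑[ i < n ] f i → ∀ i → g i ≤ f i
∑-mono-≤-tight {suc n} {f} f≤g ∑g≤∑f zero =
  +-cancelʳ-≤ _ _ _ (≤-trans ∑g≤∑f (+-monoʳ-≤ (f zero) (∑-mono-≤ (f≤g ∘ suc))))
∑-mono-≤-tight {suc n} {f} {g} f≤g ∑g≤∑f (suc i) =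
  ∑-mono-≤-tight (f≤g ∘ suc) (+-cancelˡ-≤ (g zero) _ _ (≤-trans ∑g≤∑f (+-monoˡ-≤ _ (f≤g zero)))) i

term≤∑ : ∀ {n} (f : Fin n → ℕ) i → f i ≤ ∑[ j < n ] f j
term≤∑ f zero    = m≤m+n _ _
term≤∑ f (suc i) = ≤-trans (term≤∑ (f ∘ suc) i) (m≤n+m _ _)

∑-pointMass : ∀ {n} (i : Fin n) (f : Fin n → ℕ) → ∑[ j < n ] (if does (j ≟ i) then f j else 0) ≡ f i
∑-pointMass {suc n} zero    f = trans (cong (f zero +_) (sum-replicate-zero n)) (+-identityʳ _)
∑-pointMass {suc n} (suc i) f = ∑-pointMass i (f ∘ suc)

∑-1 : ∀ n → ∑[ i < n ] 1 ≡ n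
∑-1 zero    = refl
∑-1 (suc n) = cong suc (∑-1 n)

∑-all-but-one : ∀ {n} (i : Fin n) → ∑[ j < n ] ⟦ not (does (j ≟ i)) ⟧ ≡ n ∸ 1
∑-all-but-one {suc n}       zero    = ∑-1 n
∑-all-but-one {suc (suc n)} (suc i) = cong suc (∑-all-but-one i)

sum-map-allFin : ∀ {n} (f : Fin n → ℕ) → List.sum (map f (allFin n)) ≡ ∑[ i < n ] f i
sum-map-allFin f = trans (cong List.sum (map-tabulate id f)) (sum-tabulate f)
  where
  sum-tabulate : ∀ {n} (f : Fin n → ℕ) → List.sum (tabulate f) ≡ ∑[ i < n ] f i
  sum-tabulate {zero}  f = refl
  sum-tabulate {suc n} f = cong (f zero +_) (sum-tabulate (f ∘ suc))

module _ {p} {P : ℕ → Set p} (P? : Decidable P) where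

  least-witness : ∀ {m} → P m → ∃[ k ] P k × (∀ {j} → P j → k ≤ j)
  least-witness = go (<-wellFounded _)
    where
    go : ∀ {m} → Acc _<_ m → P m → ∃[ k ] P k × (∀ {j} → P j → k ≤ j)
    go {m} (acc below) pm with anyUpTo? P? m
    ... | yes (j , j<m , pj) = go (below j<m) pj
    ... | no ∄j<m            = m , pm , λ {j} pj → ≮⇒≥ (λ j<m → ∄j<m (j , j<m , pj))

record RootedSpanningTree {n} (G : Graph n) : Set where
  field
    root          : Fin n
    parent        : Fin n → Fin n
    height        : Fin n → ℕ
    parent-adj    : ∀ {u} → u ≢ root → Adj G u (parent u)
    parent-height : ∀ {u} → u ≢ root → height (parent u) < height u

module _ {n} {G : Graph n} (r : Fin n) where

  WithinDistance : ℕ → Fin n → Set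
  WithinDistance zero    u = u ≡ r
  WithinDistance (suc k) u = u ≡ r ⊎ ∃[ w ] Adj G u w × WithinDistance k w

  withinDistance? : ∀ k → Decidable (WithinDistance k)
  withinDistance? zero    u = u ≟ r
  withinDistance? (suc k) u = u ≟ r ⊎-dec any? (λ w → G u w Bool.≟ true ×-dec withinDistance? k w)

  walk⇒withinDistance : ∀ {u} → Walk G u r → ∃[ k ] WithinDistance k u
  walk⇒withinDistance here = zero , refl
  walk⇒withinDistance (step {w = w} adj walk) with walk⇒withinDistance walk
  ... | k , w-near = suc k , inj₂ (w , adj , w-near)

connected⇒rootedSpanningTree : ∀ {n} {G : Graph n} → Connected G → Fin n → RootedSpanningTree G
connected⇒rootedSpanningTree {n} {G} connected r = record
  { root          = r
  ; parent        = parent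
  ; height        = distance
  ; parent-adj    = proj₁ ∘ parent-spec
  ; parent-height = proj₂ ∘ parent-spec
  }
  where
  shortest : ∀ u → ∃[ k ] WithinDistance r k u × (∀ {j} → WithinDistance r j u → k ≤ j)
  shortest u = least-witness (λ k → withinDistance? r k u) (proj₂ (walk⇒withinDistance r (connected u r)))

  distance : Fin n → ℕ
  distance u = proj₁ (shortest u)

  within-distance : ∀ u → WithinDistance r (distance u) u
  within-distance u = proj₁ (proj₂ (shortest u))

  distance-minimal : ∀ {k u} → WithinDistance r k u → distance u ≤ k
  distance-minimal {u = u} = proj₂ (proj₂ (shortest u))

  closer-neighbour : ∀ {k u} → WithinDistance r k u → u ≢ r → ∃[ w ] Adj G u w × distance w < k
  closer-neighbour {zero}  u≡r                  u≢r = contradiction u≡r u≢r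
  closer-neighbour {suc k} (inj₁ u≡r)           u≢r = contradiction u≡r u≢r
  closer-neighbour {suc k} (inj₂ (w , adj , d)) _   = w , adj , s≤s (distance-minimal d)

  parent : Fin n → Fin n
  parent u with u ≟ r
  ... | yes _  = r
  ... | no u≢r = proj₁ (closer-neighbour (within-distance u) u≢r)

  parent-spec : ∀ {u} → u ≢ r → Adj G u (parent u) × distance (parent u) < distance u
  parent-spec {u} u≢r with u ≟ r
  ... | yes u≡r  = contradiction u≡r u≢r
  ... | no  u≢r′ = proj₂ (closer-neighbour (within-distance u) u≢r′)

module _ {n} {G : Graph n} (G-sym : ∀ u v → G u v ≡ G v u) (T : RootedSpanningTree G) where
  open RootedSpanningTree T

  nonRoot : Fin n → Bool
  nonRoot u = not (does (u ≟ root))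

  nonRoot⇒≢ : ∀ {u} → nonRoot u ≡ true → u ≢ root
  nonRoot⇒≢ {u} nr with u ≟ root
  ... | yes _  = contradiction nr λ ()
  ... | no u≢r = u≢r

  parent-≢ : ∀ {u} → u ≢ root → u ≢ parent u
  parent-≢ u≢r u≡pu = <-irrefl (cong height (sym u≡pu)) (parent-height u≢r)

  no-2-cycle : ∀ {u} → u ≢ root → parent u ≢ root → parent (parent u) ≢ u
  no-2-cycle {u} u≢r pu≢r ppu≡u =
    <-asym (parent-height u≢r) (subst (λ w → height w < height (parent u)) ppu≡u (parent-height pu≢r))

  module _ (R : Fin n → Fin n → Bool)
           (R-total : ∀ {u v} → u ≢ v → Adj G u v → R u v ≡ true ⊎ R v u ≡ true) where

    -- The tree edge {u, parent u} of a non-root u is counted at u by toParent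
    -- or at parent u by toChild, according to its orientation under R.
    toParent toChild : Fin n → Fin n → ℕ
    toParent v u = if does (u ≟ parent v) then ⟦ nonRoot v ∧ R v u ⟧ else 0
    toChild  v u = if does (v ≟ parent u) then ⟦ nonRoot u ∧ R v u ⟧ else 0

    toParent≤ : ∀ v u → toParent v u ≤ ⟦ G v u ∧ R v u ⟧
    toParent≤ v u with u ≟ parent v
    ... | yes refl = ⟦∧⟧-monoˡ (R v u) (parent-adj ∘ nonRoot⇒≢)
    ... | no _     = z≤n

    toChild≤ : ∀ v u → toChild v u ≤ ⟦ G v u ∧ R v u ⟧
    toChild≤ v u with v ≟ parent u
    ... | yes refl = ⟦∧⟧-monoˡ (R v u) (λ nr → trans (G-sym (parent u) u) (parent-adj (nonRoot⇒≢ nr)))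
    ... | no _     = z≤n

    toParent⊎toChild≡0 : ∀ v u → toParent v u ≡ 0 ⊎ toChild v u ≡ 0
    toParent⊎toChild≡0 v u with u ≟ parent v
    ... | no _ = inj₁ refl
    ... | yes refl with v ≟ root
    ...   | yes _ = inj₁ refl
    ...   | no v≢r with v ≟ parent (parent v)
    ...     | no _ = inj₂ refl
    ...     | yes v≡ppv with parent v ≟ root
    ...       | yes _   = inj₂ refl
    ...       | no pv≢r = contradiction (sym v≡ppv) (no-2-cycle v≢r pv≢r)

    toParent+toChild≤ : ∀ v u → toParent v u + toChild v u ≤ ⟦ G v u ∧ R v u ⟧
    toParent+toChild≤ v u with toParent⊎toChild≡0 v u
    ... | inj₁ up≡0   rewrite up≡0 = toChild≤ v u
    ... | inj₂ down≡0 rewrite down≡0 | +-identityʳ (toParent v u) = toParent≤ v u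

    up down : Fin n → ℕ
    up   u = ⟦ nonRoot u ∧ R u (parent u) ⟧
    down u = ⟦ nonRoot u ∧ R (parent u) u ⟧

    nonRoot≤up+down : ∀ u → ⟦ nonRoot u ⟧ ≤ up u + down u
    nonRoot≤up+down u with u ≟ root
    ... | yes _  = z≤n
    ... | no u≢r with R-total (parent-≢ u≢r) (parent-adj u≢r)
    ...   | inj₁ R-up   rewrite R-up   = s≤s z≤n
    ...   | inj₂ R-down rewrite R-down = m≤n+m 1 _

    ∑-toParent : ∀ v → ∑[ u < n ] toParent v u ≡ up v
    ∑-toParent v = ∑-pointMass (parent v) _

    ∑-toChild : ∀ u → ∑[ v < n ] toChild v u ≡ down u
    ∑-toChild u = ∑-pointMass (parent u) _

    n∸1≤∑-orientedEdges : n ∸ 1 ≤ ∑[ v < n ] ∑[ u < n ] ⟦ G v u ∧ R v u ⟧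
    n∸1≤∑-orientedEdges = begin
      n ∸ 1                                        ≡⟨ sym (∑-all-but-one root) ⟩
      ∑[ u < n ] ⟦ nonRoot u ⟧                     ≤⟨ ∑-mono-≤ nonRoot≤up+down ⟩
      ∑[ u < n ] (up u + down u)                   ≡⟨ ∑-distrib-+ up down ⟩
      (∑[ v < n ] up v) + (∑[ u < n ] down u)      ≡⟨ sym (cong₂ _+_ (sum-cong-≗ ∑-toParent) (sum-cong-≗ ∑-toChild)) ⟩
      ∑∑ toParent + (∑[ u < n ] ∑[ v < n ] toChild v u) ≡⟨ cong (∑∑ toParent +_) (∑-comm (λ u v → toChild v u)) ⟩
      ∑∑ toParent + ∑∑ toChild                     ≡⟨ sym (∑∑-distrib-+ toParent toChild) ⟩
      ∑[ v < n ] ∑[ u < n ] (toParent v u + toChild v u)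
                                                   ≤⟨ ∑-mono-≤ (λ v → ∑-mono-≤ (toParent+toChild≤ v)) ⟩
      ∑[ v < n ] ∑[ u < n ] ⟦ G v u ∧ R v u ⟧      ∎
      where
      open ≤-Reasoning
      ∑∑ : (Fin n → Fin n → ℕ) → ℕ
      ∑∑ f = ∑[ v < n ] ∑[ u < n ] f v u

      ∑∑-distrib-+ : ∀ f g → ∑∑ (λ v u → f v u + g v u) ≡ ∑∑ f + ∑∑ g
      ∑∑-distrib-+ f g = trans (sum-cong-≗ {n} (λ v → ∑-distrib-+ (f v) (g v))) (∑-distrib-+ {n} _ _)

module _ {n : ℕ} where
  open import Data.List.Membership.DecPropositional (_≟_ {n}) using (_∈_; _∉_; _∈?_)

  -- The firings after the last firing of v; all of them if v never fires.
  afterLast : Fin n → List (Fin n) → List (Fin n)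
  afterLast v [] = []
  afterLast v (i ∷ is) with v ∈? is
  ... | yes _ = afterLast v is
  ... | no _ with i ≟ v
  ...   | yes _ = is
  ...   | no _  = i ∷ is

  afterLast-total : ∀ {u v} is → u ≢ v → u ∈ is → v ∈ is → u ∈ afterLast v is ⊎ v ∈ afterLast u is
  afterLast-total {u} {v} (i ∷ is) u≢v u∈ v∈ with u ∈? is | v ∈? is
  ... | yes u∈is | yes v∈is = afterLast-total is u≢v u∈is v∈is
  ... | yes u∈is | no v∉is with v∈ | i ≟ v
  ...   | here v≡i   | no i≢v = contradiction (sym v≡i) i≢v
  ...   | there v∈is | _      = contradiction v∈is v∉is
  ...   | _          | yes _  = inj₁ u∈is
  afterLast-total {u} {v} (i ∷ is) u≢v u∈ v∈ | no u∉is | yes v∈is with u∈ | i ≟ u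
  ...   | here u≡i   | no i≢u = contradiction (sym u≡i) i≢u
  ...   | there u∈is | _      = contradiction u∈is u∉is
  ...   | _          | yes _  = inj₂ v∈is
  afterLast-total {u} {v} (i ∷ is) u≢v u∈ v∈ | no u∉is | no v∉is with u∈ | v∈
  ... | here u≡i   | here v≡i   = contradiction (trans u≡i (sym v≡i)) u≢v
  ... | there u∈is | _          = contradiction u∈is u∉is
  ... | _          | there v∈is = contradiction v∈is v∉is

  module _ (G : Graph n) where

    neighboursIn : Fin n → List (Fin n) → ℕ
    neighboursIn v js = ∑[ u < n ] ⟦ G v u ∧ does (u ∈? js) ⟧

    laterNeighbours : List (Fin n) → Fin n → ℕ
    laterNeighbours is v = neighboursIn v (afterLast v is)

    neighboursIn-[] : ∀ v → neighboursIn v [] ≡ 0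
    neighboursIn-[] v = trans (sum-cong-≗ (λ u → cong ⟦_⟧ (Bool.∧-zeroʳ (G v u)))) (sum-replicate-zero n)

    neighboursIn-∷ : ∀ v i js → neighboursIn v (i ∷ js) ≤ ⟦ G v i ⟧ + neighboursIn v js
    neighboursIn-∷ v i js = begin
      neighboursIn v (i ∷ js)
        ≤⟨ ∑-mono-≤ (λ u → ⟦∧∨⟧≤ (G v u) _ _) ⟩
      ∑[ u < n ] ((if does (u ≟ i) then ⟦ G v u ⟧ else 0) + ⟦ G v u ∧ does (u ∈? js) ⟧)
        ≡⟨ ∑-distrib-+ {n} _ _ ⟩
      ∑[ u < n ] (if does (u ≟ i) then ⟦ G v u ⟧ else 0) + neighboursIn v js
        ≡⟨ cong (_+ neighboursIn v js) (∑-pointMass i _) ⟩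
      ⟦ G v i ⟧ + neighboursIn v js
        ∎
      where open ≤-Reasoning

    neighboursIn≤deg : ∀ v js → neighboursIn v js ≤ deg G v
    neighboursIn≤deg v js =
      subst (neighboursIn v js ≤_) (sym (sum-map-allFin (λ u → ⟦ G v u ⟧)))
            (∑-mono-≤ λ u → ⟦∧⟧≤⟦⟧ (G v u) _)

    module _ (G-sym : ∀ u v → G u v ≡ G v u) where

      fire-≢ : ∀ {i v} c → i ≢ v → fire G i c v ≡ c v + ⟦ G v i ⟧
      fire-≢ {i} {v} c i≢v with i ≟ v
      ... | yes i≡v = contradiction i≡v i≢v
      ... | no _ rewrite G-sym i v with G v i
      ...   | true  = +-comm 1 (c v)
      ...   | false = sym (+-identityʳ (c v))

      fireSeq-unfired : ∀ {v} js c → v ∉ js → c v + neighboursIn v js ≤ fireSeq G js c v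
      fireSeq-unfired {v} [] c _ = ≤-reflexive (trans (cong (c v +_) (neighboursIn-[] v)) (+-identityʳ (c v)))
      fireSeq-unfired {v} (i ∷ js) c v∉ = begin
        c v + neighboursIn v (i ∷ js)         ≤⟨ +-monoʳ-≤ (c v) (neighboursIn-∷ v i js) ⟩
        c v + (⟦ G v i ⟧ + neighboursIn v js) ≡⟨ sym (+-assoc (c v) _ _) ⟩
        c v + ⟦ G v i ⟧ + neighboursIn v js   ≡⟨ cong (_+ neighboursIn v js) (sym (fire-≢ c i≢v)) ⟩
        fire G i c v + neighboursIn v js      ≤⟨ fireSeq-unfired js (fire G i c) (v∉ ∘ there) ⟩
        fireSeq G js (fire G i c) v           ∎
        where
        open ≤-Reasoning
        i≢v : i ≢ v
        i≢v i≡v = v∉ (here (sym i≡v))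

      laterNeighbours≤fireSeq : ∀ {v} is c → laterNeighbours is v ≤ fireSeq G is c v
      laterNeighbours≤fireSeq [] c = m+n≤o⇒n≤o (c _) (fireSeq-unfired [] c λ ())
      laterNeighbours≤fireSeq {v} (i ∷ is) c with v ∈? is
      ... | yes _ = laterNeighbours≤fireSeq is (fire G i c)
      ... | no v∉is with i ≟ v
      ...   | yes refl = m+n≤o⇒n≤o _ (fireSeq-unfired is (fire G v c) v∉is)
      ...   | no i≢v   = m+n≤o⇒n≤o _ (fireSeq-unfired (i ∷ is) c λ { (here v≡i) → i≢v (sym v≡i)
                                                                    ; (there v∈is) → v∉is v∈is })

      module _ {is : List (Fin n)} {c : Config G} (fixed : ∀ j → fireSeq G is c j ≡ c j) where

        fired-closed : ∀ {u w} → u ∈ is → Adj G u w → w ∈ is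
        fired-closed {u} {w} u∈is adj with w ∈? is
        ... | yes w∈is = w∈is
        ... | no w∉is  = contradiction w-bound (<⇒≱ (m<m+n (c w) (≤-trans u-counted (term≤∑ _ u))))
          where
          w-bound : c w + neighboursIn w is ≤ c w
          w-bound = subst (c w + neighboursIn w is ≤_) (fixed w) (fireSeq-unfired is c w∉is)

          u-counted : 1 ≤ ⟦ G w u ∧ does (u ∈? is) ⟧
          u-counted rewrite G-sym w u | adj | dec-true (u ∈? is) u∈is = ≤-refl

        all-fired : Connected G → ∀ {x} → x ∈ is → ∀ v → v ∈ is
        all-fired connected {x} x∈is v = go (connected x v) x∈is
          where
          go : ∀ {u} → Walk G u v → u ∈ is → v ∈ is
          go here            u∈is = u∈is
          go (step adj walk) u∈is = go walk (fired-closed u∈is adj)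

      n∸1≤∑-laterNeighbours : Connected G → ∀ {is c} → is ≢ [] → (∀ j → fireSeq G is c j ≡ c j) →
                              n ∸ 1 ≤ ∑[ v < n ] laterNeighbours is v
      n∸1≤∑-laterNeighbours connected {[]}     []≢[] _     = contradiction refl []≢[]
      n∸1≤∑-laterNeighbours connected {x ∷ is} _     fixed =
        n∸1≤∑-orientedEdges G-sym (connected⇒rootedSpanningTree connected x) R R-total
        where
        R : Fin n → Fin n → Bool
        R v u = does (u ∈? afterLast v (x ∷ is))

        fired : ∀ v → v ∈ x ∷ is
        fired = all-fired fixed connected (here refl)

        R-total : ∀ {u v} → u ≢ v → Adj G u v → R u v ≡ true ⊎ R v u ≡ true
        R-total {u} {v} u≢v _ with afterLast-total (x ∷ is) u≢v (fired u) (fired v)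
        ... | inj₁ u∈ = inj₂ (dec-true (u ∈? _) u∈)
        ... | inj₂ v∈ = inj₁ (dec-true (v ∈? _) v∈)

lemma3p2 : (n : ℕ) → 1 ≤ n → (T : Graph n) → IsTree T →
    (μ : Config T) → MinimallySelfReachable T μ →
    (i : Fin n) → μ i ≤ deg T i
lemma3p2 n _ T ((T-sym , _) , connected , _) μ ((is , is≢[] , _ , μ-fixed) , μ-total) i =
  ≤-trans (∑-mono-≤-tight later≤μ ∑μ≤∑later i) (neighboursIn≤deg T i (afterLast i is))
  where
  later : Fin n → ℕ
  later = laterNeighbours T is

  later≤μ : ∀ v → later v ≤ μ v
  later≤μ v = subst (later v ≤_) (μ-fixed v) (laterNeighbours≤fireSeq T T-sym is μ)

  ∑μ≤∑later : ∑[ v < n ] μ v ≤ ∑[ v < n ] later v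
  ∑μ≤∑later = begin
    ∑[ v < n ] μ v      ≡⟨ sym (sum-map-allFin μ) ⟩
    totalChips T μ      ≡⟨ μ-total ⟩
    n ∸ 1               ≤⟨ n∸1≤∑-laterNeighbours T T-sym connected is≢[] μ-fixed ⟩
    ∑[ v < n ] later v  ∎
    where open ≤-Reasoning
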